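{- Let $G$ be a finite simple graph of order $n$ and let $H$ be a finite simple graph. (i) If $G$ has at least one connected component of order greater than two, then $\gamma_R(G\Box H)\le (n+1)\gamma_R(H)-2\gamma(H)$. (ii) If $G$ is a Roman graph, then $\gamma_R(G\Box H)\le 2n\left(\gamma_R(H)-\gamma(H)\right)+2\gamma(G)\left(2\gamma(H)-\gamma_R(H)\right)$.
   Context: $\gamma(X)$ denotes the domination number of a graph $X$ (minimum size of a set $D$ such that every vertex outside $D$ has a neighbor in $D$). A Roman dominating function on $X$ is a map $f:V(X)\to\{0,1,2\}$ such that every vertex $v$ with $f(v)=0$ has a neighbor $u$ with $f(u)=2$; $\gamma_R(X)$ is the minimum of $\sum_v f(v)$ over such $f$. A graph $G$ is Roman if $\gamma_R(G)=2\gamma(G)$. The Cartesian product $G\Box H$ has vertex set $V(G)\times V(H)$, with $(g,h)\sim(g',h')$ iff ($g=g'$ and $h\sim h'$) or ($g\sim g'$ and $h=h'$). -}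

module Defs where

open import Data.Nat using (ℕ; zero; suc; _*_; _≤_)
open import Data.Bool using (Bool; true; false; _∧_; _∨_)
open import Data.Fin using (Fin; zero; suc; remQuot; _≟_)
open import Data.Fin.Subset using (Subset; _∈_; _∉_; ∣_∣)
open import Data.List using (tabulate)
open import Data.Nat.ListAction using (sum)
open import Data.Product using (Σ; ∃; _×_; _,_)
open import Relation.Binary.PropositionalEquality using (_≡_; _≢_)
open import Relation.Nullary.Decidable using (⌊_⌋)

record Graph : Set where
  constructor mkGraph
  field
    order : ℕ
    adj   : Fin order → Fin order → Bool
open Graph public

record IsSimple (G : Graph) : Set where
  field
    adj-sym    : ∀ u v → adj G u v ≡ adj G v u
    adj-irrefl : ∀ v → adj G v v ≡ false

Adj : (G : Graph) → Fin (order G) → Fin (order G) → Set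
Adj G u v = adj G u v ≡ true

-- Cartesian product G □ H; vertex (g,h) is encoded as combine g h : Fin (|G| * |H|).
_□_ : Graph → Graph → Graph
G □ H = mkGraph (order G * order H) λ x y → go (remQuot (order H) x) (remQuot (order H) y)
  where
  go : Fin (order G) × Fin (order H) → Fin (order G) × Fin (order H) → Bool
  go (g , h) (g' , h') = (⌊ g ≟ g' ⌋ ∧ adj H h h') ∨ (adj G g g' ∧ ⌊ h ≟ h' ⌋)

IsDominatingSet : (G : Graph) → Subset (order G) → Set
IsDominatingSet G D = ∀ v → v ∉ D → ∃ λ u → u ∈ D × Adj G u v

IsDominationNumber : Graph → ℕ → Set
IsDominationNumber G k =
  (Σ (Subset (order G)) λ D → IsDominatingSet G D × ∣ D ∣ ≡ k)
  × (∀ D → IsDominatingSet G D → k ≤ ∣ D ∣)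

two : Fin 3
two = suc (suc zero)

IsRomanDominating : (G : Graph) → (Fin (order G) → Fin 3) → Set
IsRomanDominating G f = ∀ v → f v ≡ zero → ∃ λ u → Adj G u v × f u ≡ two

weight : {n : ℕ} → (Fin n → Fin 3) → ℕ
weight f = sum (tabulate λ v → Data.Fin.toℕ (f v))

IsRomanDominationNumber : Graph → ℕ → Set
IsRomanDominationNumber G k =
  (Σ (Fin (order G) → Fin 3) λ f → IsRomanDominating G f × weight f ≡ k)
  × (∀ f → IsRomanDominating G f → k ≤ weight f)

IsRoman : Graph → Set
IsRoman G = ∀ r d → IsRomanDominationNumber G r → IsDominationNumber G d → r ≡ 2 * d

data Reach (G : Graph) : Fin (order G) → Fin (order G) → Set where
  here : ∀ {u} → Reach G u u
  step : ∀ {u v w} → Adj G u v → Reach G v w → Reach G u w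

HasComponentOfOrder>2 : Graph → Set
HasComponentOfOrder>2 G =
  ∃ λ v → ∃ λ a → ∃ λ b → ∃ λ c →
    a ≢ b × a ≢ c × b ≢ c × Reach G v a × Reach G v b × Reach G v c

module Submission where

-- Fix a minimum Roman dominating function f of H and let b be the number of vertices where it
-- takes the value 2. The support of f dominates H, so γ(H) + b ≤ γR(H). Given a Roman dominating
-- function g of G of weight w ≤ n, the function on G □ H that vanishes on V(G) × f⁻¹(0), copies g on
-- V(G) × f⁻¹(1) and is 2 on V(G) × f⁻¹(2) is Roman dominating, of weight
-- w γR(H) + 2(n − w) b ≤ w γR(H) + 2(n − w)(γR(H) − γ(H)).
-- For (i), a component of order > 2 has a vertex c with two distinct neighbours a, b; taking g = 2 at c,
-- 0 at a and b and 1 elsewhere gives w = n − 1. For (ii), take g = 2 on a minimum dominating set (and 0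
-- off it) or g ≡ 1, so that w = min(n, 2γ(G)); the right-hand side of (ii) exceeds the bound above by
-- (2γ(G) − w)(2γ(H) − γR(H)) ≥ 0. So (ii) holds for every G, Roman or not.

open import Defs

module RomanDomination where

  open import Data.Bool using (Bool; true; false; not; if_then_else_; _∨_)
  open import Data.Bool.Properties using (∨-zeroʳ)
  open import Data.Empty using (⊥-elim)
  open import Data.Fin using (Fin; zero; suc; toℕ; _↑ˡ_; _↑ʳ_; combine; remQuot; _≟_)
  open import Data.Fin.Properties using (remQuot-combine)
  open import Data.Fin.Subset using (Subset; _∈_; ∣_∣; inside; outside)
  open import Data.Nat using (ℕ; zero; suc; _+_; _*_; _≤_; _≤?_)
  open import Data.Nat.Properties
    using (+-*-semiring; +-assoc; +-identityʳ; *-zeroʳ; *-identityʳ; *-comm; *-distribʳ-+; +-cancelʳ-≡;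
           +-monoˡ-≤; ≤-reflexive; <⇒≤; ≰⇒>)
  open import Algebra.Properties.Semiring.Sum +-*-semiring
    using (sum-syntax; ∑-comm; ∑-distrib-+; *-distribˡ-sum; sum-cong-≗)
  open import Data.Product using (∃; _×_; _,_; proj₁; proj₂; uncurry)
  open import Data.Sum using (_⊎_; inj₁; inj₂)
  open import Data.Vec using ([]; _∷_; lookup; tabulate)
  open import Data.Vec.Properties using (lookup∘tabulate; []=⇒lookup; lookup⇒[]=)
  open import Function using (_∘_; case_of_)
  open import Relation.Binary.PropositionalEquality
  open import Relation.Nullary.Decidable using (does; yes; no; dec-true; ⌊_⌋; isYes≗does)
  open ≡-Reasoning

  𝟙 : Bool → ℕ
  𝟙 true  = 1
  𝟙 false = 0

  weight≡∑ : ∀ {n} (f : Fin n → Fin 3) → weight f ≡ ∑[ v < n ] toℕ (f v)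
  weight≡∑ {zero}  f = refl
  weight≡∑ {suc n} f = cong (toℕ (f zero) +_) (weight≡∑ (f ∘ suc))

  ∑-const : ∀ n c → ∑[ i < n ] c ≡ n * c
  ∑-const zero    c = refl
  ∑-const (suc n) c = cong (c +_) (∑-const n c)

  ∑-↑ : ∀ m {n} (f : Fin (m + n) → ℕ) →
        ∑[ i < m + n ] f i ≡ ∑[ i < m ] f (i ↑ˡ n) + ∑[ j < n ] f (m ↑ʳ j)
  ∑-↑ zero    f = refl
  ∑-↑ (suc m) f = trans (cong (f zero +_) (∑-↑ m (f ∘ suc))) (sym (+-assoc (f zero) _ _))

  ∑-combine : ∀ m n (f : Fin (m * n) → ℕ) →
              ∑[ v < m * n ] f v ≡ ∑[ i < m ] ∑[ j < n ] f (combine i j)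
  ∑-combine zero    n f = refl
  ∑-combine (suc m) n f =
    trans (∑-↑ n f) (cong (∑[ j < n ] f (j ↑ˡ m * n) +_) (∑-combine m n (f ∘ (n ↑ʳ_))))

  -- Stated with does rather than ⌊_⌋: only does computes through the suc/suc clause of _≟_.
  ∑-𝟙-≟ : ∀ {n} (a : Fin n) → ∑[ x < n ] 𝟙 (does (x ≟ a)) ≡ 1
  ∑-𝟙-≟ {suc n} zero    = cong suc (trans (∑-const n 0) (*-zeroʳ n))
  ∑-𝟙-≟ {suc n} (suc a) = ∑-𝟙-≟ a

  ∣p∣≡∑𝟙 : ∀ {n} (p : Subset n) → ∣ p ∣ ≡ ∑[ i < n ] 𝟙 (lookup p i)
  ∣p∣≡∑𝟙 []            = refl
  ∣p∣≡∑𝟙 (inside  ∷ p) = cong suc (∣p∣≡∑𝟙 p)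
  ∣p∣≡∑𝟙 (outside ∷ p) = ∣p∣≡∑𝟙 p


  one : Fin 3
  one = suc zero

  support : ∀ {n} → (Fin n → Fin 3) → Subset n
  support f = tabulate λ v → not (does (f v ≟ zero))

  twos : ∀ {n} → (Fin n → Fin 3) → ℕ
  twos {n} f = ∑[ v < n ] 𝟙 (does (f v ≟ two))

  ∈-support : ∀ {n} (f : Fin n → Fin 3) {v x} → f v ≡ suc x → v ∈ support f
  ∈-support f {v} fv≡suc = lookup⇒[]= v (support f)
    (trans (lookup∘tabulate _ v) (cong (λ y → not (does (y ≟ zero))) fv≡suc))

  weight≡∣support∣+twos : ∀ {n} (f : Fin n → Fin 3) → weight f ≡ ∣ support f ∣ + twos f
  weight≡∣support∣+twos {n} f = begin
    weight f                                              ≡⟨ weight≡∑ f ⟩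
    ∑[ v < n ] toℕ (f v)                                  ≡⟨ sum-cong-≗ (λ v → split (f v)) ⟩
    ∑[ v < n ] (nonzero (f v) + 𝟙 (does (f v ≟ two)))     ≡⟨ ∑-distrib-+ (nonzero ∘ f) _ ⟩
    ∑[ v < n ] nonzero (f v) + twos f                     ≡⟨ cong (_+ twos f) ∣support∣ ⟨
    ∣ support f ∣ + twos f                                ∎
    where
    nonzero : Fin 3 → ℕ
    nonzero x = 𝟙 (not (does (x ≟ zero)))
    split : ∀ x → toℕ x ≡ nonzero x + 𝟙 (does (x ≟ two))
    split zero             = refl
    split (suc zero)       = refl
    split (suc (suc zero)) = refl
    ∣support∣ : ∣ support f ∣ ≡ ∑[ v < n ] nonzero (f v)
    ∣support∣ = trans (∣p∣≡∑𝟙 (support f)) (sum-cong-≗ {n} λ v → cong 𝟙 (lookup∘tabulate _ v))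

  twice : ∀ {n} → Subset n → Fin n → Fin 3
  twice D v = if lookup D v then two else zero

  ones : ∀ {n} → Fin n → Fin 3
  ones _ = one

  weight-twice : ∀ {n} (D : Subset n) → weight (twice D) ≡ 2 * ∣ D ∣
  weight-twice {n} D = begin
    weight (twice D)                        ≡⟨ weight≡∑ (twice D) ⟩
    ∑[ v < n ] toℕ (twice D v)        ≡⟨ sum-cong-≗ (λ v → double (lookup D v)) ⟩
    ∑[ v < n ] (2 * 𝟙 (lookup D v))   ≡⟨ *-distribˡ-sum 2 (𝟙 ∘ lookup D) ⟨
    2 * ∑[ v < n ] 𝟙 (lookup D v)     ≡⟨ cong (2 *_) (∣p∣≡∑𝟙 D) ⟨
    2 * ∣ D ∣                               ∎
    where
    double : ∀ b → toℕ (if b then two else zero) ≡ 2 * 𝟙 b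
    double true  = refl
    double false = refl

  weight-ones : ∀ {n} → weight (ones {n}) ≡ n
  weight-ones {n} = trans (weight≡∑ (ones {n})) (trans (∑-const n 1) (*-identityʳ n))

  module _ {G : Graph} where

    support-dominating : ∀ {f} → IsRomanDominating G f → IsDominatingSet G (support f)
    support-dominating {f} rdf v v∉ with f v in fv
    ... | zero  = let u , uv , fu = rdf v fv in u , ∈-support f fu , uv
    ... | suc _ = ⊥-elim (v∉ (∈-support f fv))

    twice-roman : ∀ {D} → IsDominatingSet G D → IsRomanDominating G (twice D)
    twice-roman {D} dom v dv with lookup D v in Dv
    twice-roman {D} dom v () | true
    ... | false = let u , u∈D , uv = dom v (λ v∈D → case trans (sym ([]=⇒lookup v∈D)) Dv of λ ())
                  in u , uv , cong (λ b → if b then two else zero) ([]=⇒lookup u∈D)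

    ones-roman : IsRomanDominating G ones
    ones-roman v ()

  Cherry : Graph → Set
  Cherry G = ∃ λ c → ∃ λ a → ∃ λ b → a ≢ b × Adj G c a × Adj G c b

  module _ {G : Graph} (simple : IsSimple G) where
    open IsSimple simple

    Near : Fin (order G) → Fin (order G) → Set
    Near u w = w ≡ u ⊎ Adj G u w

    near-or-cherry : ∀ {u w} → Reach G u w → Near u w ⊎ Cherry G
    near-or-cherry here = inj₁ (inj₁ refl)
    near-or-cherry {u} (step {v = v} {w = w} uv vw⁺) with near-or-cherry vw⁺
    ... | inj₂ cherry        = inj₂ cherry
    ... | inj₁ (inj₁ refl)   = inj₁ (inj₂ uv)
    ... | inj₁ (inj₂ vw) with u ≟ w
    ...   | yes refl = inj₁ (inj₁ refl)
    ...   | no  u≢w  = inj₂ (v , u , w , u≢w , trans (adj-sym v u) uv , vw)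

    cherry-of-near : ∀ {v a b c} → a ≢ b → a ≢ c → b ≢ c →
                     Near v a → Near v b → Near v c → Cherry G
    cherry-of-near a≢b _   _   (inj₁ refl) (inj₁ refl) _           = ⊥-elim (a≢b refl)
    cherry-of-near _   a≢c _   (inj₁ refl) _           (inj₁ refl) = ⊥-elim (a≢c refl)
    cherry-of-near _   _   b≢c _           (inj₁ refl) (inj₁ refl) = ⊥-elim (b≢c refl)
    cherry-of-near _   _   b≢c (inj₁ refl) (inj₂ vb)   (inj₂ vc)   = _ , _ , _ , b≢c , vb , vc
    cherry-of-near _   a≢c _   (inj₂ va)   (inj₁ refl) (inj₂ vc)   = _ , _ , _ , a≢c , va , vc
    cherry-of-near a≢b _   _   (inj₂ va)   (inj₂ vb)   _           = _ , _ , _ , a≢b , va , vb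

    component>2⇒cherry : HasComponentOfOrder>2 G → Cherry G
    component>2⇒cherry (_ , _ , _ , _ , a≢b , a≢c , b≢c , ra , rb , rc)
      with near-or-cherry ra | near-or-cherry rb | near-or-cherry rc
    ... | inj₁ na     | inj₁ nb     | inj₁ nc     = cherry-of-near a≢b a≢c b≢c na nb nc
    ... | inj₂ cherry | _           | _           = cherry
    ... | _           | inj₂ cherry | _           = cherry
    ... | _           | _           | inj₂ cherry = cherry

    adj⇒≢ : ∀ {u v} → Adj G u v → v ≢ u
    adj⇒≢ {u} uv refl = case trans (sym uv) (adj-irrefl u) of λ ()

    module _ (c a b : Fin (order G)) (a≢b : a ≢ b) (ca : Adj G c a) (cb : Adj G c b) where

      cherryRoman : Fin (order G) → Fin 3
      cherryRoman x = if does (x ≟ c) then two else if does (x ≟ a) ∨ does (x ≟ b) then zero else one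

      cherryRoman-centre : cherryRoman c ≡ two
      cherryRoman-centre rewrite dec-true (c ≟ c) refl = refl

      cherryRoman-roman : IsRomanDominating G cherryRoman
      cherryRoman-roman v h with v ≟ c | v ≟ a | v ≟ b
      cherryRoman-roman v () | yes _ | _        | _
      cherryRoman-roman v h  | no _  | yes refl | _        = c , ca , cherryRoman-centre
      cherryRoman-roman v h  | no _  | no _     | yes refl = c , cb , cherryRoman-centre
      cherryRoman-roman v () | no _  | no _     | no _

      weight-cherryRoman : weight cherryRoman + 1 ≡ order G
      weight-cherryRoman = +-cancelʳ-≡ 1 (weight cherryRoman + 1) (order G) (begin
        weight cherryRoman + 1 + 1
          ≡⟨ cong₂ (λ p q → weight cherryRoman + p + q) (∑-𝟙-≟ a) (∑-𝟙-≟ b) ⟨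
        weight cherryRoman + ∑[ x < order G ] δ a x + ∑[ x < order G ] δ b x
          ≡⟨ cong (λ w → w + ∑[ x < order G ] δ a x + ∑[ x < order G ] δ b x) (weight≡∑ cherryRoman) ⟩
        ∑[ x < order G ] toℕ (cherryRoman x) + ∑[ x < order G ] δ a x + ∑[ x < order G ] δ b x
          ≡⟨ cong (_+ ∑[ x < order G ] δ b x) (∑-distrib-+ (toℕ ∘ cherryRoman) (δ a)) ⟨
        ∑[ x < order G ] (toℕ (cherryRoman x) + δ a x) + ∑[ x < order G ] δ b x
          ≡⟨ ∑-distrib-+ (λ x → toℕ (cherryRoman x) + δ a x) (δ b) ⟨
        ∑[ x < order G ] (toℕ (cherryRoman x) + δ a x + δ b x)
          ≡⟨ sum-cong-≗ {order G} pointwise ⟩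
        ∑[ x < order G ] (1 + δ c x)
          ≡⟨ ∑-distrib-+ (λ _ → 1) (δ c) ⟩
        ∑[ x < order G ] 1 + ∑[ x < order G ] δ c x
          ≡⟨ cong₂ _+_ (trans (∑-const (order G) 1) (*-identityʳ (order G))) (∑-𝟙-≟ c) ⟩
        order G + 1 ∎)
        where
        δ : Fin (order G) → Fin (order G) → ℕ
        δ y x = 𝟙 (does (x ≟ y))
        pointwise : ∀ x → toℕ (cherryRoman x) + δ a x + δ b x ≡ 1 + δ c x
        pointwise x with x ≟ c | x ≟ a | x ≟ b
        ... | yes refl | yes refl | _        = ⊥-elim (adj⇒≢ ca refl)
        ... | yes refl | no _     | yes refl = ⊥-elim (adj⇒≢ cb refl)
        ... | yes _    | no _     | no _     = refl
        ... | no _     | yes refl | yes refl = ⊥-elim (a≢b refl)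
        ... | no _     | yes _    | no _     = refl
        ... | no _     | no _     | yes _    = refl
        ... | no _     | no _     | no _     = refl

  layer : Fin 3 → Fin 3 → Fin 3
  layer zero             _ = zero
  layer (suc zero)       y = y
  layer (suc (suc zero)) _ = two

  _⊠_ : ∀ {m n} → (Fin m → Fin 3) → (Fin n → Fin 3) → Fin (m * n) → Fin 3
  _⊠_ {n = n} g f v = uncurry (λ x y → layer (f y) (g x)) (remQuot n v)

  ⊠-combine : ∀ {m n} (g : Fin m → Fin 3) (f : Fin n → Fin 3) x y →
              (g ⊠ f) (combine x y) ≡ layer (f y) (g x)
  ⊠-combine g f x y = cong (uncurry λ x y → layer (f y) (g x)) (remQuot-combine x y)

  ⌊≟-refl⌋ : ∀ {n} (x : Fin n) → ⌊ x ≟ x ⌋ ≡ true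
  ⌊≟-refl⌋ x = trans (isYes≗does (x ≟ x)) (dec-true (x ≟ x) refl)

  module _ {G H : Graph} where

    -- remQuot unfolds to a swapped pair, so rewriting has to go through the projections.
    □-adj : ∀ {u v x y x′ y′} →
            remQuot (order H) u ≡ (x , y) → remQuot (order H) v ≡ (x′ , y′) →
            (x ≡ x′ × Adj H y y′) ⊎ (Adj G x x′ × y ≡ y′) → Adj (G □ H) u v
    □-adj {x = x} ru rv (inj₁ (refl , yy′))
      rewrite cong proj₁ ru | cong proj₂ ru | cong proj₁ rv | cong proj₂ rv | ⌊≟-refl⌋ x | yy′ = refl
    □-adj {y = y} ru rv (inj₂ (xx′ , refl))
      rewrite cong proj₁ ru | cong proj₂ ru | cong proj₁ rv | cong proj₂ rv | ⌊≟-refl⌋ y | xx′ = ∨-zeroʳ _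

    module _ {g f} (rg : IsRomanDominating G g) (rf : IsRomanDominating H f) where

      layer-dominated : ∀ {v x y} → remQuot (order H) v ≡ (x , y) → layer (f y) (g x) ≡ zero →
                        ∃ λ u → Adj (G □ H) u v × (g ⊠ f) u ≡ two
      layer-dominated {x = x} {y} rv h with f y in fy
      ... | zero =
        let y′ , y′y , fy′ = rf y fy
        in  combine x y′ , □-adj (remQuot-combine x y′) rv (inj₁ (refl , y′y))
          , trans (⊠-combine g f x y′) (cong (λ z → layer z (g x)) fy′)
      ... | suc zero =
        let x′ , x′x , gx′ = rg x h
        in  combine x′ y , □-adj (remQuot-combine x′ y) rv (inj₂ (x′x , refl))
          , trans (⊠-combine g f x′ y) (cong₂ layer fy gx′)
      layer-dominated rv () | suc (suc zero)

      ⊠-roman : IsRomanDominating (G □ H) (g ⊠ f)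
      ⊠-roman v = layer-dominated refl

  ∑-layer : ∀ {m} (g : Fin m → Fin 3) {d} → weight g + d ≡ m → ∀ x →
            ∑[ i < m ] toℕ (layer x (g i)) ≡ weight g * toℕ x + 2 * (d * 𝟙 (does (x ≟ two)))
  ∑-layer {m} g {d} w+d≡m zero = begin
    ∑[ i < m ] 0                   ≡⟨ ∑-const m 0 ⟩
    m * 0                          ≡⟨ *-zeroʳ m ⟩
    0                              ≡⟨ cong₂ _+_ (*-zeroʳ (weight g)) (cong (2 *_) (*-zeroʳ d)) ⟨
    weight g * 0 + 2 * (d * 0)     ∎
  ∑-layer {m} g {d} w+d≡m (suc zero) = begin
    ∑[ i < m ] toℕ (g i)           ≡⟨ weight≡∑ g ⟨
    weight g                       ≡⟨ +-identityʳ (weight g) ⟨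
    weight g + 0                   ≡⟨ cong₂ _+_ (*-identityʳ (weight g)) (cong (2 *_) (*-zeroʳ d)) ⟨
    weight g * 1 + 2 * (d * 0)     ∎
  ∑-layer {m} g {d} w+d≡m (suc (suc zero)) = begin
    ∑[ i < m ] 2                   ≡⟨ ∑-const m 2 ⟩
    m * 2                          ≡⟨ cong (_* 2) w+d≡m ⟨
    (weight g + d) * 2             ≡⟨ *-distribʳ-+ 2 (weight g) d ⟩
    weight g * 2 + d * 2           ≡⟨ cong (weight g * 2 +_) (trans (cong (2 *_) (*-identityʳ d)) (*-comm 2 d)) ⟨
    weight g * 2 + 2 * (d * 1)     ∎

  weight-⊠ : ∀ {m n} (g : Fin m → Fin 3) (f : Fin n → Fin 3) {d} → weight g + d ≡ m →
             weight (g ⊠ f) ≡ weight g * weight f + 2 * (d * twos f)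
  weight-⊠ {m} {n} g f {d} w+d≡m = begin
    weight (g ⊠ f)
      ≡⟨ weight≡∑ (g ⊠ f) ⟩
    ∑[ v < m * n ] toℕ ((g ⊠ f) v)
      ≡⟨ ∑-combine m n _ ⟩
    ∑[ x < m ] ∑[ y < n ] toℕ ((g ⊠ f) (combine x y))
      ≡⟨ sum-cong-≗ {m} (λ x → sum-cong-≗ {n} λ y → cong toℕ (⊠-combine g f x y)) ⟩
    ∑[ x < m ] ∑[ y < n ] toℕ (layer (f y) (g x))
      ≡⟨ ∑-comm (λ x y → toℕ (layer (f y) (g x))) ⟩
    ∑[ y < n ] ∑[ x < m ] toℕ (layer (f y) (g x))
      ≡⟨ sum-cong-≗ {n} (∑-layer g w+d≡m ∘ f) ⟩
    ∑[ y < n ] (weight g * toℕ (f y) + 2 * (d * two? y))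
      ≡⟨ ∑-distrib-+ (λ y → weight g * toℕ (f y)) (λ y → 2 * (d * two? y)) ⟩
    ∑[ y < n ] (weight g * toℕ (f y)) + ∑[ y < n ] (2 * (d * two? y))
      ≡⟨ cong₂ _+_ (*-distribˡ-sum (weight g) (toℕ ∘ f)) (*-distribˡ-sum 2 (λ y → d * two? y)) ⟨
    weight g * ∑[ y < n ] toℕ (f y) + 2 * ∑[ y < n ] (d * two? y)
      ≡⟨ cong₂ _+_ (cong (weight g *_) (weight≡∑ f)) (cong (2 *_) (*-distribˡ-sum d two?)) ⟨
    weight g * weight f + 2 * (d * twos f)
      ∎
    where
    two? : Fin n → ℕ
    two? y = 𝟙 (does (f y ≟ two))

  module _ {G : Graph} where

    γ+twos≤weight : ∀ {γ f} → IsDominationNumber G γ → IsRomanDominating G f → γ + twos f ≤ weight f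
    γ+twos≤weight {γ} {f} (_ , minimal) rf =
      subst (γ + twos f ≤_) (sym (weight≡∣support∣+twos f))
        (+-monoˡ-≤ (twos f) (minimal (support f) (support-dominating rf)))

    γR≤2γ : ∀ {γR γ} → IsRomanDominationNumber G γR → IsDominationNumber G γ → γR ≤ 2 * γ
    γR≤2γ {γR} (_ , minimal) ((D , dom , ∣D∣≡γ) , _) =
      subst (γR ≤_) (trans (weight-twice D) (cong (2 *_) ∣D∣≡γ)) (minimal (twice D) (twice-roman dom))

    roman≤min[n,2γ] : ∀ {γ} → IsDominationNumber G γ →
                      ∃ λ g → IsRomanDominating G g × weight g ≤ order G × weight g ≤ 2 * γ
    roman≤min[n,2γ] {γ} ((D , dom , ∣D∣≡γ) , _) with 2 * γ ≤? order G
    ... | yes 2γ≤n = twice D , twice-roman dom , subst (_≤ order G) (sym w≡2γ) 2γ≤n , ≤-reflexive w≡2γ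
      where w≡2γ = trans (weight-twice D) (cong (2 *_) ∣D∣≡γ)
    ... | no  2γ≰n = ones , ones-roman , ≤-reflexive weight-ones
                   , subst (_≤ 2 * γ) (sym weight-ones) (<⇒≤ (≰⇒> 2γ≰n))

    component>2⇒roman : IsSimple G → HasComponentOfOrder>2 G →
                        ∃ λ g → IsRomanDominating G g × weight g + 1 ≡ order G
    component>2⇒roman simple comp =
      let c , a , b , a≢b , ca , cb = component>2⇒cherry simple comp
      in  cherryRoman simple c a b a≢b ca cb , cherryRoman-roman simple c a b a≢b ca cb
        , weight-cherryRoman simple c a b a≢b ca cb

  γR-□≤ : ∀ {G H r g f d} → IsRomanDominationNumber (G □ H) r →
            IsRomanDominating G g → IsRomanDominating H f → weight g + d ≡ order G →
            r ≤ weight g * weight f + 2 * (d * twos f)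
  γR-□≤ {g = g} {f} (_ , minimal) rg rf w+d≡n =
    subst (_ ≤_) (weight-⊠ g f w+d≡n) (minimal (g ⊠ f) (⊠-roman rg rf))

open RomanDomination

open import Data.Nat as ℕ using (ℕ)
open import Data.Nat.Properties using (m≤n⇒∃[o]m+o≡n; m≤m+n)
open import Data.Integer using (ℤ; +_; _+_; _-_; _*_; _≤_; -_; 0ℤ; +≤+; nonNegative)
open import Data.Integer.Properties
  using (≤-trans; ≤-reflexive; +-monoʳ-≤; +-monoˡ-≤; *-monoˡ-≤-nonNeg; *-monoʳ-≤-nonNeg;
         i≤i+j; i≤j⇒0≤j-i; pos-*; module ≤-Reasoning)
open import Data.Integer.Tactic.RingSolver using (solve-∀)
open import Data.Product using (_×_; _,_; proj₁; proj₂)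
open import Relation.Binary.PropositionalEquality using (_≡_; refl; cong; cong₂; trans; subst)

m+k≡n⇒+k≡+n-+m : ∀ {m k n} → m ℕ.+ k ≡ n → + k ≡ + n - + m
m+k≡n⇒+k≡+n-+m {m} {k} refl = identity (+ m) (+ k)
  where
  identity : ∀ x y → y ≡ x + y - x
  identity = solve-∀

m+k≤n⇒+k≤+n-+m : ∀ {m k n} → m ℕ.+ k ℕ.≤ n → + k ≤ + n - + m
m+k≤n⇒+k≤+n-+m {m} {k} h =
  ≤-trans (≤-reflexive (m+k≡n⇒+k≡+n-+m {m} {k} refl)) (+-monoˡ-≤ (- + m) (+≤+ h))

m≤2*n⇒+m≤+2*+n : ∀ {m n} → m ℕ.≤ 2 ℕ.* n → + m ≤ + 2 * + n
m≤2*n⇒+m≤+2*+n {m} {n} h = subst (+ m ≤_) (pos-* 2 n) (+≤+ h)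

0≤i*j : ∀ {i j} → 0ℤ ≤ i → 0ℤ ≤ j → 0ℤ ≤ i * j
0≤i*j {j = j} 0≤i 0≤j = *-monoʳ-≤-nonNeg j ⦃ nonNegative 0≤j ⦄ 0≤i

productBound : (w n R γ : ℕ) → ℤ
productBound w n R γ = + w * + R + + 2 * ((+ n - + w) * (+ R - + γ))

γR-□≤productBound : ∀ {G H γH γRH r g} →
                    IsDominationNumber H γH → IsRomanDominationNumber H γRH →
                    IsRomanDominationNumber (G □ H) r → IsRomanDominating G g → weight g ℕ.≤ order G →
                    + r ≤ productBound (weight g) (order G) γRH γH
γR-□≤productBound {G} {γH = γH} {r = r} {g} isγH ((f , rf , refl) , _) isγR□ rg w≤n = begin
  + r
    ≤⟨ +≤+ (γR-□≤ isγR□ rg rf w+d≡n) ⟩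
  + (w ℕ.* weight f ℕ.+ 2 ℕ.* (d ℕ.* twos f))
    ≡⟨ cong₂ _+_ (pos-* w (weight f)) (trans (pos-* 2 (d ℕ.* twos f)) (cong (+ 2 *_) (pos-* d (twos f)))) ⟩
  + w * + weight f + + 2 * (+ d * + twos f)
    ≤⟨ +-monoʳ-≤ (+ w * + weight f) (*-monoˡ-≤-nonNeg (+ 2) (*-monoˡ-≤-nonNeg (+ d)
         (m+k≤n⇒+k≤+n-+m (γ+twos≤weight isγH rf)))) ⟩
  + w * + weight f + + 2 * (+ d * (+ weight f - + γH))
    ≡⟨ cong (λ z → + w * + weight f + + 2 * (z * (+ weight f - + γH))) (m+k≡n⇒+k≡+n-+m {w} {d} w+d≡n) ⟩
  productBound w (order G) (weight f) γH
    ∎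
  where
  open ≤-Reasoning
  w = weight g
  d = proj₁ (m≤n⇒∃[o]m+o≡n w≤n)
  w+d≡n = proj₂ (m≤n⇒∃[o]m+o≡n w≤n)

productBound⇒≤[n+1]R-2γ : ∀ {X} w {n} R γ → w ℕ.+ 1 ≡ n → X ≤ productBound w n R γ →
                          X ≤ (+ n + + 1) * + R - + 2 * + γ
productBound⇒≤[n+1]R-2γ w R γ refl X≤ = ≤-trans X≤ (≤-reflexive (identity (+ w) (+ R) (+ γ)))
  where
  identity : ∀ w R γ → w * R + + 2 * ((w + + 1 - w) * (R - γ)) ≡ (w + + 1 + + 1) * R - + 2 * γ
  identity = solve-∀

productBound⇒≤2n[R-γ]+2γ′[2γ-R] : ∀ {X} w n R γ γ′ → w ℕ.≤ 2 ℕ.* γ′ → R ℕ.≤ 2 ℕ.* γ →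
                                  X ≤ productBound w n R γ →
                                  X ≤ + 2 * + n * (+ R - + γ) + + 2 * + γ′ * (+ 2 * + γ - + R)
productBound⇒≤2n[R-γ]+2γ′[2γ-R] {X} w n R γ γ′ w≤2γ′ R≤2γ X≤ = begin
  X                                                          ≤⟨ X≤ ⟩
  productBound w n R γ                                       ≤⟨ i≤i+j _ slack ⦃ nonNegative 0≤slack ⦄ ⟩
  productBound w n R γ + slack                               ≡⟨ identity (+ w) (+ n) (+ R) (+ γ) (+ γ′) ⟩
  + 2 * + n * (+ R - + γ) + + 2 * + γ′ * (+ 2 * + γ - + R)    ∎
  where
  open ≤-Reasoning
  slack : ℤ
  slack = (+ 2 * + γ′ - + w) * (+ 2 * + γ - + R)
  0≤slack : 0ℤ ≤ slack
  0≤slack = 0≤i*j (i≤j⇒0≤j-i (m≤2*n⇒+m≤+2*+n {w} {γ′} w≤2γ′))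
                  (i≤j⇒0≤j-i (m≤2*n⇒+m≤+2*+n {R} {γ} R≤2γ))
  identity : ∀ w n R γ γ′ →
             w * R + + 2 * ((n - w) * (R - γ)) + (+ 2 * γ′ - w) * (+ 2 * γ - R)
             ≡ + 2 * n * (R - γ) + + 2 * γ′ * (+ 2 * γ - R)
  identity = solve-∀

theorem13 : (G H : Graph) → IsSimple G → IsSimple H →
    (∀ (gH rH r : ℕ) → IsDominationNumber H gH → IsRomanDominationNumber H rH →
    IsRomanDominationNumber (G □ H) r →
    (HasComponentOfOrder>2 G →
    + r ≤ (+ order G + + 1) * + rH - + 2 * + gH)
    × (∀ (gG : ℕ) → IsDominationNumber G gG → IsRoman G →
    + r ≤ + 2 * + order G * (+ rH - + gH) + + 2 * + gG * (+ 2 * + gH - + rH)))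
theorem13 G H simpleG _ gH rH r isγH isγRH isγR□ = part-i , part-ii
  where
  part-i : HasComponentOfOrder>2 G → + r ≤ (+ order G + + 1) * + rH - + 2 * + gH
  part-i comp =
    let g , rg , w+1≡n = component>2⇒roman simpleG comp
        w≤n = subst (weight g ℕ.≤_) w+1≡n (m≤m+n (weight g) 1)
    in  productBound⇒≤[n+1]R-2γ (weight g) rH gH w+1≡n (γR-□≤productBound isγH isγRH isγR□ rg w≤n)

  part-ii : ∀ gG → IsDominationNumber G gG → IsRoman G →
            + r ≤ + 2 * + order G * (+ rH - + gH) + + 2 * + gG * (+ 2 * + gH - + rH)
  part-ii gG isγG _ =
    let g , rg , w≤n , w≤2γG = roman≤min[n,2γ] isγG
    in  productBound⇒≤2n[R-γ]+2γ′[2γ-R] (weight g) (order G) rH gH gG w≤2γG (γR≤2γ isγRH isγH)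
          (γR-□≤productBound isγH isγRH isγR□ rg w≤n)
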